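{- Let $\mathbb{F}$ be a field, let $n,m\ge1$ and $\min\{n,m\}\ge r\ge0$. Let $f:\mathbb{F}^n\times\mathbb{F}^m\to\mathbb{F}^t$ be a bilinear lossless $(r,r,0)$-two-source rank condenser given by $f(v,w)=(v^{\mathrm{tr}}E_kw)_{k\in[t]}$ with $E_k\in\mathbb{F}^{n\times m}$. Then $\{E_k\}_{k\in[t]}$ are parity checks of a linear rank-metric code of distance at least $r+1$; that is, every nonzero matrix $M\in\mathbb{F}^{n\times m}$ with $\mathrm{tr}(E_k^{\mathrm{tr}}M)=0$ for all $k\in[t]$ has $\mathrm{rank}\,M\ge r+1$.
   Context: A function $f:\mathbb{F}^n\times\mathbb{F}^m\to\mathbb{F}^t$ is an $(r,s,0)$-two-source rank condenser (lossless) if for all sets $A\subseteq\mathbb{F}^n$, $B\subseteq\mathbb{F}^m$ with $\mathrm{rank}\,A=r$ and $\mathrm{rank}\,B=s$, the set $f(A\times B)=\{f(v,w)\}_{v\in A,w\in B}$ has rank $rs$. A linear rank-metric code $\mathcal{C}\subseteq\mathbb{F}^{n\times m}$ has distance $d$ if every nonzero element has rank at least $d$; its parity checks are a spanning set of $\mathcal{C}^\perp$ under the inner product $\langle M,N\rangle=\mathrm{tr}(M^{\mathrm{tr}}N)$. -}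

module Defs where

open import Level using (Level; _⊔_; suc)
open import Data.Nat using (ℕ; zero) renaming (suc to sucℕ)
open import Data.Fin using (Fin) renaming (zero to fz; suc to fs)
open import Data.Product using (Σ; ∃; _×_)
open import Algebra.Bundles using (CommutativeRing)
open import Relation.Nullary using (¬_)

record Field (c ℓ : Level) : Set (Level.suc (c ⊔ ℓ)) where
  field
    commutativeRing : CommutativeRing c ℓ
  open CommutativeRing commutativeRing public
  field
    0≉1     : ¬ (0# ≈ 1#)
    inverse : ∀ x → ¬ (x ≈ 0#) → ∃ λ y → x * y ≈ 1#

module LinAlg {c ℓ : Level} (F : Field c ℓ) where
  open Field F

  Vect : ℕ → Set c
  Vect n = Fin n → Carrier

  Mat : ℕ → ℕ → Set c
  Mat n m = Fin n → Fin m → Carrier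

  ∑ : ∀ {k} → (Fin k → Carrier) → Carrier
  ∑ {zero}   g = 0#
  ∑ {sucℕ k} g = g fz + ∑ (λ i → g (fs i))

  _≈ᵥ_ : ∀ {n} → Vect n → Vect n → Set ℓ
  u ≈ᵥ v = ∀ i → u i ≈ v i

  zeroV : ∀ {n} → Vect n
  zeroV _ = 0#

  lincomb : ∀ {n k} → (Fin k → Carrier) → (Fin k → Vect n) → Vect n
  lincomb cs vs i = ∑ (λ j → cs j * vs j i)

  LinIndep : ∀ {n k} → (Fin k → Vect n) → Set (c ⊔ ℓ)
  LinIndep {n} {k} vs =
    (cs : Fin k → Carrier) → lincomb cs vs ≈ᵥ zeroV → ∀ j → cs j ≈ 0#

  InSpan : ∀ {n k} → (Fin k → Vect n) → Vect n → Set (c ⊔ ℓ)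
  InSpan {n} {k} vs u = Σ (Fin k → Carrier) λ cs → u ≈ᵥ lincomb cs vs

  VSet : ℕ → Set (Level.suc (c ⊔ ℓ))
  VSet n = Vect n → Set (c ⊔ ℓ)

  HasRank : ∀ {n} → VSet n → ℕ → Set (c ⊔ ℓ)
  HasRank {n} A k =
    Σ (Fin k → Vect n) λ vs →
      (∀ j → A (vs j)) × LinIndep vs × (∀ u → A u → InSpan vs u)

  bilin : ∀ {n m t} → (Fin t → Mat n m) → Vect n → Vect m → Vect t
  bilin E v w k = ∑ (λ i → ∑ (λ j → v i * (E k i j * w j)))

  image : ∀ {n m t} → (Vect n → Vect m → Vect t) → VSet n → VSet m → VSet t
  image f A B u = ∃ λ v → ∃ λ w → A v × B w × (u ≈ᵥ f v w)

  IsLosslessCondenser : ∀ {n m t} → ℕ → ℕ → (Vect n → Vect m → Vect t) → Set (Level.suc (c ⊔ ℓ))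
  IsLosslessCondenser {n} {m} r s f =
    (A : VSet n) (B : VSet m) → HasRank A r → HasRank B s →
    HasRank (image f A B) (r Data.Nat.* s)

  -- transpose and trace:  tr(E^tr M) = Σ_i Σ_j E_ij M_ij
  transpose : ∀ {n m} → Mat n m → Mat m n
  transpose M j i = M i j

  trace : ∀ {n} → Mat n n → Carrier
  trace M = ∑ (λ i → M i i)

  _⊗_ : ∀ {n m p} → Mat n m → Mat m p → Mat n p
  (M ⊗ N) i k = ∑ (λ j → M i j * N j k)

  columns : ∀ {n m} → Mat n m → VSet n
  columns {n} {m} M u = Level.Lift c (∃ λ (j : Fin m) → u ≈ᵥ (λ i → M i j))

  MatRank : ∀ {n m} → Mat n m → ℕ → Set (c ⊔ ℓ)
  MatRank M k = HasRank (columns M) k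

  IsZeroMat : ∀ {n m} → Mat n m → Set ℓ
  IsZeroMat M = ∀ i j → M i j ≈ 0#

module Submission where

-- Suppose M ≠ 0 satisfies tr(E_kᵀ M) = 0 for all k and rank M = d ≤ r.
-- Factor M = Σ_{l<d} v_l w_lᵀ with {v_l}, {w_l} independent; then
-- Σ_l f(v_l, w_l) = (tr(E_kᵀ M))_k = 0.  Extend both families to independent
-- families a, b of length r.  By losslessness the r² grid values f(a_i, b_j)
-- span a space of dimension r², but the relation (d ≥ 1 diagonal terms)
-- shows that r² − 1 of them span everything, contradicting Steinitz.
--
-- Equality in F is an arbitrary setoid, so "x ≈ 0 or not" is undecidable:
-- case distinctions happen under ¬¬ (harmless, every auxiliary goal is ⊥),
-- and independence is produced constructively by carrying a dual family.

open import Defs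
open import Level using (Level; Lift; lift; lower; _⊔_)
open import Data.Nat as ℕ using (ℕ; zero; suc; _≤_; _<_; s≤s; _≤?_; _∸_)
open import Data.Nat.Properties using (m≤n⇒m≤1+n; <⇒≤; n<1+n; m∸n+n≡m; ≰⇒>; ≤-pred)
open import Data.Fin using (Fin; punchIn; punchOut; _↑ʳ_; combine; remQuot; _≟_)
  renaming (zero to fz; suc to fs)
open import Data.Fin.Properties using (remQuot-combine; combine-injectiveˡ; punchIn-punchOut; ↑ʳ-injective)
open import Data.Vec.Functional using (_∷_; head; tail; insertAt)
open import Data.Vec.Functional.Properties using (insertAt-lookup; insertAt-punchIn)
open import Data.Product using (Σ; ∃; _×_; _,_; proj₁; proj₂)
open import Data.Empty using (⊥; ⊥-elim)
open import Function using (_∘_)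
open import Relation.Nullary using (¬_; yes; no)
open import Relation.Binary.PropositionalEquality as P using (_≡_; _≢_)

module Proof {c ℓ : Level} (F : Field c ℓ) where
  open Field F hiding (zero)
  open LinAlg F
  open import Relation.Binary.Reasoning.Setoid setoid
  open import Algebra.Properties.Semiring.Sum semiring as Sum using (sum)
  open import Algebra.Properties.Ring ring using (-‿distribˡ-*; x[y-z]≈xy-xz; [y-z]x≈yx-zx)
  open import Algebra.Properties.AbelianGroup +-abelianGroup
    using (⁻¹-∙-comm; ε⁻¹≈ε; x∙y⁻¹≈ε⇒x≈y; x≈y⇒x∙y⁻¹≈ε; inverseˡ-unique)
  open import Algebra.Properties.CommutativeSemigroup +-commutativeSemigroup using (interchange)
  open import Algebra.Properties.CommutativeSemigroup *-commutativeSemigroup using (x∙yz≈y∙xz)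

  x-0≈x : ∀ x → x - 0# ≈ x
  x-0≈x x = trans (+-cong refl ε⁻¹≈ε) (+-identityʳ x)

  cancel-leading : ∀ a₀ b₀ z Y A B → b₀ * z ≈ 1# →
                   (a₀ * Y + A) - (a₀ * z) * (b₀ * Y + B) ≈ A - (a₀ * z) * B
  cancel-leading a₀ b₀ z Y A B b₀z≈1 = begin
    (a₀ * Y + A) - (a₀ * z) * (b₀ * Y + B)
      ≈⟨ +-cong refl (-‿cong (trans (distribˡ (a₀ * z) (b₀ * Y) B) (+-cong a₀Y refl))) ⟩
    (a₀ * Y + A) - (a₀ * Y + (a₀ * z) * B)
      ≈⟨ +-cong refl (⁻¹-∙-comm _ _) ⟨
    (a₀ * Y + A) + (- (a₀ * Y) + - ((a₀ * z) * B))
      ≈⟨ interchange _ _ _ _ ⟩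
    (a₀ * Y - a₀ * Y) + (A - (a₀ * z) * B)
      ≈⟨ +-cong (-‿inverseʳ _) refl ⟩
    0# + (A - (a₀ * z) * B)
      ≈⟨ +-identityˡ _ ⟩
    A - (a₀ * z) * B ∎
    where
    a₀Y : (a₀ * z) * (b₀ * Y) ≈ a₀ * Y
    a₀Y = begin
      (a₀ * z) * (b₀ * Y) ≈⟨ *-assoc a₀ z (b₀ * Y) ⟩
      a₀ * (z * (b₀ * Y)) ≈⟨ *-cong refl (x∙yz≈y∙xz z b₀ Y) ⟩
      a₀ * (b₀ * (z * Y)) ≈⟨ *-cong refl (*-assoc b₀ z Y) ⟨
      a₀ * ((b₀ * z) * Y) ≈⟨ *-cong refl (*-cong b₀z≈1 refl) ⟩
      a₀ * (1# * Y)       ≈⟨ *-cong refl (*-identityˡ Y) ⟩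
      a₀ * Y ∎

  ∑≈sum : ∀ {k} (g : Fin k → Carrier) → ∑ g ≈ sum g
  ∑≈sum {zero}  g = refl
  ∑≈sum {suc k} g = +-cong refl (∑≈sum (tail g))

  ∑-cong : ∀ {k} {g h : Fin k → Carrier} → (∀ i → g i ≈ h i) → ∑ g ≈ ∑ h
  ∑-cong {g = g} {h} g≈h = begin
    ∑ g   ≈⟨ ∑≈sum g ⟩
    sum g ≈⟨ Sum.sum-cong-≋ g≈h ⟩
    sum h ≈⟨ ∑≈sum h ⟨
    ∑ h   ∎

  ∑-zero : ∀ {k} {g : Fin k → Carrier} → (∀ i → g i ≈ 0#) → ∑ g ≈ 0#
  ∑-zero {k} g≈0 = trans (∑-cong g≈0) (trans (∑≈sum {k} (λ _ → 0#)) (Sum.sum-replicate-zero k))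

  ∑-+ : ∀ {k} (g h : Fin k → Carrier) → ∑ (λ i → g i + h i) ≈ ∑ g + ∑ h
  ∑-+ g h = begin
    ∑ (λ i → g i + h i)   ≈⟨ ∑≈sum (λ i → g i + h i) ⟩
    sum (λ i → g i + h i) ≈⟨ Sum.∑-distrib-+ g h ⟩
    sum g + sum h         ≈⟨ +-cong (∑≈sum g) (∑≈sum h) ⟨
    ∑ g + ∑ h             ∎

  ∑-*ˡ : ∀ {k} x (g : Fin k → Carrier) → ∑ (λ i → x * g i) ≈ x * ∑ g
  ∑-*ˡ x g = begin
    ∑ (λ i → x * g i)   ≈⟨ ∑≈sum (λ i → x * g i) ⟩
    sum (λ i → x * g i) ≈⟨ Sum.*-distribˡ-sum x g ⟨
    x * sum g           ≈⟨ *-cong refl (∑≈sum g) ⟨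
    x * ∑ g             ∎

  ∑-*ʳ : ∀ {k} x (g : Fin k → Carrier) → ∑ (λ i → g i * x) ≈ ∑ g * x
  ∑-*ʳ x g = begin
    ∑ (λ i → g i * x)   ≈⟨ ∑≈sum (λ i → g i * x) ⟩
    sum (λ i → g i * x) ≈⟨ Sum.*-distribʳ-sum x g ⟨
    sum g * x           ≈⟨ *-cong (∑≈sum g) refl ⟨
    ∑ g * x             ∎

  ∑-neg : ∀ {k} (g : Fin k → Carrier) → ∑ (λ i → - g i) ≈ - ∑ g
  ∑-neg {zero}  g = sym ε⁻¹≈ε
  ∑-neg {suc k} g = trans (+-cong refl (∑-neg (tail g))) (⁻¹-∙-comm _ _)

  ∑-sub : ∀ {k} (g h : Fin k → Carrier) → ∑ (λ i → g i - h i) ≈ ∑ g - ∑ h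
  ∑-sub g h = trans (∑-+ g (λ i → - h i)) (+-cong refl (∑-neg h))

  ∑-swap : ∀ {k k′} (g : Fin k → Fin k′ → Carrier) →
           ∑ (λ i → ∑ (g i)) ≈ ∑ (λ j → ∑ (λ i → g i j))
  ∑-swap g = begin
    ∑ (λ i → ∑ (g i))             ≈⟨ ∑-cong (λ i → ∑≈sum (g i)) ⟩
    ∑ (λ i → sum (g i))           ≈⟨ ∑≈sum (λ i → sum (g i)) ⟩
    sum (λ i → sum (g i))         ≈⟨ Sum.∑-comm g ⟩
    sum (λ j → sum (λ i → g i j)) ≈⟨ ∑≈sum (λ j → sum (λ i → g i j)) ⟨
    ∑ (λ j → sum (λ i → g i j))   ≈⟨ ∑-cong (λ j → ∑≈sum (λ i → g i j)) ⟨
    ∑ (λ j → ∑ (λ i → g i j))     ∎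

  ∑-remove : ∀ {k} (s : Fin (suc k)) (g : Fin (suc k) → Carrier) →
             ∑ g ≈ g s + ∑ (λ p → g (punchIn s p))
  ∑-remove s g = begin
    ∑ g                                ≈⟨ ∑≈sum g ⟩
    sum g                              ≈⟨ Sum.sum-remove {i = s} g ⟩
    g s + sum (λ p → g (punchIn s p))  ≈⟨ +-cong refl (∑≈sum (λ p → g (punchIn s p))) ⟨
    g s + ∑ (λ p → g (punchIn s p))    ∎

  δ : ∀ {k} → Fin k → Vect k
  δ fz     fz     = 1#
  δ fz     (fs _) = 0#
  δ (fs _) fz     = 0#
  δ (fs i) (fs j) = δ i j

  δ-sym : ∀ {k} (i j : Fin k) → δ i j ≡ δ j i
  δ-sym fz     fz     = P.refl
  δ-sym fz     (fs j) = P.refl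
  δ-sym (fs i) fz     = P.refl
  δ-sym (fs i) (fs j) = δ-sym i j

  ∑-δ : ∀ {k} (i : Fin k) (g : Fin k → Carrier) → ∑ (λ j → δ i j * g j) ≈ g i
  ∑-δ fz     g = trans (+-cong (*-identityˡ _) (∑-zero (λ j → zeroˡ (g (fs j))))) (+-identityʳ _)
  ∑-δ (fs i) g = trans (+-cong (zeroˡ _) (∑-δ i (tail g))) (+-identityˡ _)

  ∑-δʳ : ∀ {k} (i : Fin k) (g : Fin k → Carrier) → ∑ (λ j → g j * δ j i) ≈ g i
  ∑-δʳ i g = trans (∑-cong (λ j → trans (*-comm (g j) _) (*-cong (reflexive (δ-sym j i)) refl))) (∑-δ i g)

  dot : ∀ {n} → Vect n → Vect n → Carrier
  dot x y = ∑ (λ i → x i * y i)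

  dot-comm : ∀ {n} (x y : Vect n) → dot x y ≈ dot y x
  dot-comm x y = ∑-cong (λ i → *-comm (x i) (y i))

  dot-lincomb : ∀ {n k} (x : Vect n) (cs : Fin k → Carrier) (v : Fin k → Vect n) →
                dot x (lincomb cs v) ≈ ∑ (λ l → cs l * dot x (v l))
  dot-lincomb x cs v = begin
    ∑ (λ i → x i * ∑ (λ l → cs l * v l i))   ≈⟨ ∑-cong (λ i → ∑-*ˡ (x i) (λ l → cs l * v l i)) ⟨
    ∑ (λ i → ∑ (λ l → x i * (cs l * v l i))) ≈⟨ ∑-swap (λ i l → x i * (cs l * v l i)) ⟩
    ∑ (λ l → ∑ (λ i → x i * (cs l * v l i))) ≈⟨ ∑-cong (λ l → ∑-cong (λ i → x∙yz≈y∙xz (x i) (cs l) _)) ⟩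
    ∑ (λ l → ∑ (λ i → cs l * (x i * v l i))) ≈⟨ ∑-cong (λ l → ∑-*ˡ (cs l) (λ i → x i * v l i)) ⟩
    ∑ (λ l → cs l * dot x (v l))             ∎

  dot-sub-scale : ∀ {n} (x a b : Vect n) s → dot x (λ i → a i - s * b i) ≈ dot x a - s * dot x b
  dot-sub-scale x a b s = begin
    dot x (λ i → a i - s * b i)               ≈⟨ ∑-cong (λ i → x[y-z]≈xy-xz (x i) _ _) ⟩
    ∑ (λ i → x i * a i - x i * (s * b i))     ≈⟨ ∑-sub (λ i → x i * a i) (λ i → x i * (s * b i)) ⟩
    dot x a - ∑ (λ i → x i * (s * b i))       ≈⟨ +-cong refl (-‿cong (∑-cong (λ i → x∙yz≈y∙xz (x i) s (b i)))) ⟩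
    dot x a - ∑ (λ i → s * (x i * b i))       ≈⟨ +-cong refl (-‿cong (∑-*ˡ s (λ i → x i * b i))) ⟩
    dot x a - s * dot x b                     ∎

  dot-sub-scaleˡ : ∀ {n} (a b x : Vect n) s → dot (λ i → a i - s * b i) x ≈ dot a x - s * dot b x
  dot-sub-scaleˡ a b x s = begin
    dot (λ i → a i - s * b i) x ≈⟨ dot-comm _ x ⟩
    dot x (λ i → a i - s * b i) ≈⟨ dot-sub-scale x a b s ⟩
    dot x a - s * dot x b       ≈⟨ +-cong (dot-comm x a) (-‿cong (*-cong refl (dot-comm x b))) ⟩
    dot a x - s * dot b x       ∎

  lincomb-sub : ∀ {n k} (cs ds : Fin k → Carrier) (v : Fin k → Vect n) i →
                lincomb (λ l → cs l - ds l) v i ≈ lincomb cs v i - lincomb ds v i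
  lincomb-sub cs ds v i =
    trans (∑-cong (λ l → [y-z]x≈yx-zx (v l i) (cs l) (ds l))) (∑-sub (λ l → cs l * v l i) (λ l → ds l * v l i))

  lincomb-sub-scale : ∀ {n k} (cs ds : Fin k → Carrier) s (v : Fin k → Vect n) i →
                      lincomb (λ l → cs l - s * ds l) v i ≈ lincomb cs v i - s * lincomb ds v i
  lincomb-sub-scale cs ds s v i = begin
    lincomb (λ l → cs l - s * ds l) v i            ≈⟨ lincomb-sub cs (λ l → s * ds l) v i ⟩
    lincomb cs v i - ∑ (λ l → (s * ds l) * v l i)  ≈⟨ +-cong refl (-‿cong (∑-cong (λ l → *-assoc s (ds l) (v l i)))) ⟩
    lincomb cs v i - ∑ (λ l → s * (ds l * v l i))  ≈⟨ +-cong refl (-‿cong (∑-*ˡ s (λ l → ds l * v l i))) ⟩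
    lincomb cs v i - s * lincomb ds v i            ∎

  coordinates-unique : ∀ {n k} {v : Fin k → Vect n} {cs ds : Fin k → Carrier} → LinIndep v →
                       (∀ i → lincomb cs v i ≈ lincomb ds v i) → ∀ l → cs l ≈ ds l
  coordinates-unique {v = v} {cs} {ds} indep same l =
    x∙y⁻¹≈ε⇒x≈y _ _ (indep (λ l → cs l - ds l) (λ i → trans (lincomb-sub cs ds v i) (x≈y⇒x∙y⁻¹≈ε (same i))) l)

  δ-indep : ∀ {n} → LinIndep (δ {n})
  δ-indep cs rel j = trans (sym (∑-δʳ j cs)) (rel j)

  indep-tail : ∀ {n k} (u : Fin (suc k) → Vect n) → LinIndep u → LinIndep (tail u)
  indep-tail u indep cs rel j =
    indep (0# ∷ cs) (λ i → trans (+-cong (zeroˡ _) (rel i)) (+-identityˡ 0#)) (fs j)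

  span-cong : ∀ {n k} {y : Fin k → Vect n} {u v : Vect n} → u ≈ᵥ v → InSpan y v → InSpan y u
  span-cong u≈v (cs , v≈) = cs , λ i → trans (u≈v i) (v≈ i)

  span-member : ∀ {n k} (y : Fin k → Vect n) (q : Fin k) → InSpan y (y q)
  span-member y q = δ q , λ i → sym (∑-δ q (λ l → y l i))

  span-neg : ∀ {n k} {y : Fin k → Vect n} {v : Vect n} → InSpan y v → InSpan y (λ i → - v i)
  span-neg {y = y} {v} (cs , v≈) = (λ j → - cs j) , λ i → begin
    - v i                         ≈⟨ -‿cong (v≈ i) ⟩
    - ∑ (λ j → cs j * y j i)      ≈⟨ ∑-neg (λ j → cs j * y j i) ⟨
    ∑ (λ j → - (cs j * y j i))    ≈⟨ ∑-cong (λ j → -‿distribˡ-* (cs j) (y j i)) ⟩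
    ∑ (λ j → - cs j * y j i)      ∎

  span-sum : ∀ {n k d} {y : Fin k → Vect n} (v : Fin d → Vect n) →
             (∀ l → InSpan y (v l)) → InSpan y (λ i → ∑ (λ l → v l i))
  span-sum {k = k} {d} {y} v spans = (λ j → ∑ (λ l → coeff l j)) , λ i → begin
    ∑ (λ l → v l i)                        ≈⟨ ∑-cong (λ l → proj₂ (spans l) i) ⟩
    ∑ (λ l → ∑ (λ j → coeff l j * y j i))  ≈⟨ ∑-swap (λ l j → coeff l j * y j i) ⟩
    ∑ (λ j → ∑ (λ l → coeff l j * y j i))  ≈⟨ ∑-cong (λ j → ∑-*ʳ (y j i) (λ l → coeff l j)) ⟩
    ∑ (λ j → ∑ (λ l → coeff l j) * y j i)  ∎
    where
    coeff : Fin d → Fin k → Carrier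
    coeff l = proj₁ (spans l)

  span-tail : ∀ {n k} {y : Fin (suc k) → Vect n} {v : Vect n} →
              (sp : InSpan y v) → proj₁ sp fz ≈ 0# → InSpan (tail y) v
  span-tail (cs , v≈) cs₀≈0 =
    tail cs , λ i → trans (v≈ i) (trans (+-cong (trans (*-cong cs₀≈0 refl) (zeroˡ _)) refl) (+-identityˡ _))

  head-not-in-span : ∀ {n k} (u : Fin (suc k) → Vect n) → LinIndep u → ¬ InSpan (tail u) (head u)
  head-not-in-span u indep (cs , u₀≈) = 0≉1 (sym (indep (1# ∷ λ l → - cs l) rel fz))
    where
    rel : lincomb (1# ∷ λ l → - cs l) u ≈ᵥ zeroV
    rel i = begin
      1# * u fz i + ∑ (λ l → - cs l * u (fs l) i) ≈⟨ +-cong (*-identityˡ _) (∑-cong (λ l → sym (-‿distribˡ-* (cs l) (u (fs l) i)))) ⟩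
      u fz i + ∑ (λ l → - (cs l * u (fs l) i))    ≈⟨ +-cong (u₀≈ i) (∑-neg (λ l → cs l * u (fs l) i)) ⟩
      lincomb cs (tail u) i - lincomb cs (tail u) i ≈⟨ -‿inverseʳ _ ⟩
      0# ∎

  DN : ∀ {a} → Set a → Set a
  DN A = ¬ ¬ A

  dnAll : ∀ {a k} {Q : Fin k → Set a} → (∀ i → DN (Q i)) → DN (∀ i → Q i)
  dnAll {k = zero}      qs κ = κ (λ ())
  dnAll {k = suc k} {Q} qs κ =
    qs fz λ q₀ → dnAll {Q = Q ∘ fs} (qs ∘ fs) λ q₊ → κ λ { fz → q₀ ; (fs i) → q₊ i }

  notAll : ∀ {a k} {Q : Fin k → Set a} → ¬ (∀ i → Q i) → DN (∃ λ i → ¬ Q i)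
  notAll ¬all κ = dnAll (λ i ¬q → κ (i , ¬q)) ¬all

  -- Induction on q: either every x p has zero
  -- coefficient on y fz (drop y fz), or some x s has an invertible one and
  -- we eliminate y fz using x s, losing one vector on each side.

  eliminate-indep : ∀ {n k} (x : Fin (suc k) → Vect n) (s : Fin (suc k)) (μ : Fin k → Carrier) →
                    LinIndep x → LinIndep (λ p i → x (punchIn s p) i - μ p * x s i)
  eliminate-indep {k = k} x s μ indep cs rel p = begin
    cs p                ≡⟨ insertAt-punchIn cs s ν p ⟨
    cs* (punchIn s p)   ≈⟨ indep cs* rel* (punchIn s p) ⟩
    0#                  ∎
    where
    ν : Carrier
    ν = - ∑ (λ p → cs p * μ p)
    cs* : Fin (suc k) → Carrier
    cs* = insertAt cs s ν
    expand : ∀ i → lincomb cs (λ p i → x (punchIn s p) i - μ p * x s i) i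
                   ≈ ∑ (λ p → cs p * x (punchIn s p) i) + ν * x s i
    expand i = begin
      ∑ (λ p → cs p * (x (punchIn s p) i - μ p * x s i))
        ≈⟨ ∑-cong (λ p → trans (x[y-z]≈xy-xz (cs p) _ _) (+-cong refl (-‿cong (sym (*-assoc _ _ _))))) ⟩
      ∑ (λ p → cs p * x (punchIn s p) i - (cs p * μ p) * x s i)
        ≈⟨ ∑-sub (λ p → cs p * x (punchIn s p) i) (λ p → (cs p * μ p) * x s i) ⟩
      ∑ (λ p → cs p * x (punchIn s p) i) - ∑ (λ p → (cs p * μ p) * x s i)
        ≈⟨ +-cong refl (trans (-‿cong (∑-*ʳ (x s i) (λ p → cs p * μ p))) (-‿distribˡ-* _ _)) ⟩
      ∑ (λ p → cs p * x (punchIn s p) i) + ν * x s i ∎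
    rel* : lincomb cs* x ≈ᵥ zeroV
    rel* i = begin
      ∑ (λ j → cs* j * x j i)
        ≈⟨ ∑-remove s (λ j → cs* j * x j i) ⟩
      cs* s * x s i + ∑ (λ p → cs* (punchIn s p) * x (punchIn s p) i)
        ≈⟨ +-cong (*-cong (reflexive (insertAt-lookup cs s ν)) refl)
                  (∑-cong (λ p → *-cong (reflexive (insertAt-punchIn cs s ν p)) refl)) ⟩
      ν * x s i + ∑ (λ p → cs p * x (punchIn s p) i)
        ≈⟨ +-comm _ _ ⟩
      ∑ (λ p → cs p * x (punchIn s p) i) + ν * x s i
        ≈⟨ expand i ⟨
      lincomb cs (λ p i → x (punchIn s p) i - μ p * x s i) i
        ≈⟨ rel i ⟩
      0# ∎

  eliminate-span : ∀ {n q} (y : Fin (suc q) → Vect n) {a b : Vect n} {z} →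
                   (sa : InSpan y a) (sb : InSpan y b) → proj₁ sb fz * z ≈ 1# →
                   InSpan (tail y) (λ i → a i - (proj₁ sa fz * z) * b i)
  eliminate-span y {a} {b} {z} (ca , a≈) (cb , b≈) cb₀z≈1 =
    (λ l → ca (fs l) - μ * cb (fs l)) , λ i → begin
      a i - μ * b i
        ≈⟨ +-cong (a≈ i) (-‿cong (*-cong refl (b≈ i))) ⟩
      (ca fz * y fz i + lincomb (tail ca) (tail y) i) - μ * (cb fz * y fz i + lincomb (tail cb) (tail y) i)
        ≈⟨ cancel-leading _ _ _ _ _ _ cb₀z≈1 ⟩
      lincomb (tail ca) (tail y) i - μ * lincomb (tail cb) (tail y) i
        ≈⟨ lincomb-sub-scale (tail ca) (tail cb) μ (tail y) i ⟨
      lincomb (λ l → ca (fs l) - μ * cb (fs l)) (tail y) i ∎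
    where
    μ : Carrier
    μ = ca fz * z

  steinitz : ∀ {n k} q (x : Fin k → Vect n) (y : Fin q → Vect n) →
             LinIndep x → (∀ p → InSpan y (x p)) → q < k → ⊥
  steinitz zero x y indep spans (s≤s _) = 0≉1 (sym (indep (δ fz) x₀≈0 fz))
    where
    -- the span of no vectors is {0}
    x₀≈0 : lincomb (δ fz) x ≈ᵥ zeroV
    x₀≈0 i = trans (∑-δ fz (λ l → x l i)) (proj₂ (spans fz) i)
  steinitz {k = suc k} (suc q) x y indep spans (s≤s q<k) = notAll dropHead eliminateHead
    where
    C : Fin (suc k) → Fin (suc q) → Carrier
    C p = proj₁ (spans p)
    dropHead : ¬ (∀ p → C p fz ≈ 0#)
    dropHead C₀≈0 = steinitz q x (tail y) indep (λ p → span-tail {y = y} (spans p) (C₀≈0 p)) (m≤n⇒m≤1+n q<k)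
    eliminateHead : ¬ (∃ λ s → ¬ C s fz ≈ 0#)
    eliminateHead (s , Cs₀≉0) =
      steinitz q (λ p i → x (punchIn s p) i - μ p * x s i) (tail y)
        (eliminate-indep x s μ indep)
        (λ p → eliminate-span y (spans (punchIn s p)) (spans s) (proj₂ inv))
        q<k
      where
      inv : ∃ λ z → C s fz * z ≈ 1#
      inv = inverse (C s fz) Cs₀≉0
      μ : Fin k → Carrier
      μ p = C (punchIn s p) fz * proj₁ inv

  rank-bound : ∀ {n N q} {S : VSet n} (y : Fin q → Vect n) → HasRank S N →
               (∀ u → S u → InSpan y u) → q < N → ⊥
  rank-bound {q = q} y (basis , inS , indep , _) S⊆span =
    steinitz q basis y indep (λ p → S⊆span _ (inS p))

  Dual : ∀ {n d} → (Fin d → Vect n) → (Fin d → Vect n) → Set ℓ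
  Dual u φ = ∀ l l′ → dot (φ l′) (u l) ≈ δ l l′

  dual-sym : ∀ {n d} {u φ : Fin d → Vect n} → Dual u φ → Dual φ u
  dual-sym {u = u} {φ} D l l′ = trans (dot-comm (u l′) (φ l)) (trans (D l′ l) (reflexive (δ-sym l′ l)))

  Dual⇒Indep : ∀ {n d} {u φ : Fin d → Vect n} → Dual u φ → LinIndep u
  Dual⇒Indep {u = u} {φ} D cs rel l′ = begin
    cs l′                              ≈⟨ ∑-δʳ l′ cs ⟨
    ∑ (λ l → cs l * δ l l′)            ≈⟨ ∑-cong (λ l → *-cong refl (D l l′)) ⟨
    ∑ (λ l → cs l * dot (φ l′) (u l))  ≈⟨ dot-lincomb (φ l′) cs u ⟨
    dot (φ l′) (lincomb cs u)          ≈⟨ ∑-zero (λ i → trans (*-cong refl (rel i)) (zeroʳ (φ l′ i))) ⟩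
    0#                                 ∎

  -- Dual-pair conditions are pointwise, so they transfer along u ≗ head u ∷ tail u.
  Dual-η : ∀ {n d} {u : Fin (suc d) → Vect n} →
           Σ (Fin (suc d) → Vect n) (Dual (head u ∷ tail u)) → Σ (Fin (suc d) → Vect n) (Dual u)
  Dual-η (φ , D) = φ , λ { fz l′ → D fz l′ ; (fs l) l′ → D (fs l) l′ }

  -- e minus its projection onto span u along the dual φ.
  residual : ∀ {n d} → (Fin d → Vect n) → (Fin d → Vect n) → Vect n → Vect n
  residual u φ e i = e i - lincomb (λ l → dot (φ l) e) u i

  residual-dot : ∀ {n d} (u φ : Fin d → Vect n) (x e : Vect n) →
                 dot x (residual u φ e) ≈ dot x e - ∑ (λ l → dot (φ l) e * dot x (u l))
  residual-dot u φ x e = begin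
    dot x (residual u φ e)                           ≈⟨ ∑-cong (λ i → x[y-z]≈xy-xz (x i) _ _) ⟩
    ∑ (λ i → x i * e i - x i * lincomb _ u i)        ≈⟨ ∑-sub (λ i → x i * e i) (λ i → x i * lincomb (λ l → dot (φ l) e) u i) ⟩
    dot x e - dot x (lincomb (λ l → dot (φ l) e) u)  ≈⟨ +-cong refl (-‿cong (dot-lincomb x _ u)) ⟩
    dot x e - ∑ (λ l → dot (φ l) e * dot x (u l))    ∎

  residual-⊥ : ∀ {n d} {u φ : Fin d → Vect n} → Dual u φ → ∀ e l → dot (φ l) (residual u φ e) ≈ 0#
  residual-⊥ {u = u} {φ} D e l = begin
    dot (φ l) (residual u φ e)                             ≈⟨ residual-dot u φ (φ l) e ⟩
    dot (φ l) e - ∑ (λ l′ → dot (φ l′) e * dot (φ l) (u l′)) ≈⟨ +-cong refl (-‿cong (∑-cong (λ l′ → *-cong refl (D l′ l)))) ⟩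
    dot (φ l) e - ∑ (λ l′ → dot (φ l′) e * δ l′ l)         ≈⟨ +-cong refl (-‿cong (∑-δʳ l (λ l′ → dot (φ l′) e))) ⟩
    dot (φ l) e - dot (φ l) e                              ≈⟨ -‿inverseʳ _ ⟩
    0#                                                     ∎

  residual-invariant : ∀ {n d} (u φ : Fin d → Vect n) {x : Vect n} → (∀ l → dot (u l) x ≈ 0#) →
                       ∀ e → dot x (residual u φ e) ≈ dot x e
  residual-invariant u φ {x} u⊥x e = begin
    dot x (residual u φ e)                         ≈⟨ residual-dot u φ x e ⟩
    dot x e - ∑ (λ l → dot (φ l) e * dot x (u l))  ≈⟨ +-cong refl (-‿cong (∑-zero λ l →
                                                        trans (*-cong refl (trans (dot-comm x (u l)) (u⊥x l))) (zeroʳ _))) ⟩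
    dot x e - 0#                                   ≈⟨ x-0≈x _ ⟩
    dot x e                                        ∎

  residual-zero⇒InSpan : ∀ {n d} {u φ : Fin d → Vect n} {e : Vect n} →
                         (∀ i → residual u φ e i ≈ 0#) → InSpan u e
  residual-zero⇒InSpan res≈0 = _ , λ i → x∙y⁻¹≈ε⇒x≈y _ _ (res≈0 i)

  -- Adjoining a vector e with an invertible residual coordinate to a dual
  -- pair (u, φ): the new dual vector is ψ, the residual of a scaled standard
  -- basis vector against (φ, u), and each φ l is corrected by a multiple of ψ.
  adjoin : ∀ {n d} (u φ : Fin d → Vect n) → Dual u φ → (e : Vect n) (i₀ : Fin n) →
           (∃ λ y → residual u φ e i₀ * y ≈ 1#) → Σ (Fin (suc d) → Vect n) (Dual (e ∷ u))
  adjoin {n} {d} u φ D e i₀ (y , e′y≈1) = (ψ ∷ φ′) , D′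
    where
    e′ ψ₀ ψ : Vect n
    e′ = residual u φ e
    ψ₀ j = δ i₀ j * y
    ψ = residual φ u ψ₀
    φ′ : Fin d → Vect n
    φ′ l j = φ l j - dot (φ l) e * ψ j

    u⊥ψ : ∀ l → dot (u l) ψ ≈ 0#
    u⊥ψ = residual-⊥ (dual-sym {u = u} {φ} D) ψ₀

    ψ⊥u : ∀ l → dot ψ (u l) ≈ 0#
    ψ⊥u l = trans (dot-comm ψ (u l)) (u⊥ψ l)

    ψe≈1 : dot ψ e ≈ 1#
    ψe≈1 = begin
      dot ψ e     ≈⟨ residual-invariant u φ u⊥ψ e ⟨
      dot ψ e′    ≈⟨ dot-comm ψ e′ ⟩
      dot e′ ψ    ≈⟨ residual-invariant φ u (residual-⊥ D e) ψ₀ ⟩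
      dot e′ ψ₀   ≈⟨ ∑-cong (λ j → x∙yz≈y∙xz (e′ j) (δ i₀ j) y) ⟩
      ∑ (λ j → δ i₀ j * (e′ j * y)) ≈⟨ ∑-δ i₀ (λ j → e′ j * y) ⟩
      e′ i₀ * y   ≈⟨ e′y≈1 ⟩
      1#          ∎

    φ′e≈0 : ∀ l → dot (φ′ l) e ≈ 0#
    φ′e≈0 l = begin
      dot (φ′ l) e                               ≈⟨ dot-sub-scaleˡ (φ l) ψ e _ ⟩
      dot (φ l) e - dot (φ l) e * dot ψ e        ≈⟨ +-cong refl (-‿cong (trans (*-cong refl ψe≈1) (*-identityʳ _))) ⟩
      dot (φ l) e - dot (φ l) e                  ≈⟨ -‿inverseʳ _ ⟩
      0#                                         ∎

    φ′u≈δ : ∀ l l′ → dot (φ′ l′) (u l) ≈ δ l l′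
    φ′u≈δ l l′ = begin
      dot (φ′ l′) (u l)                          ≈⟨ dot-sub-scaleˡ (φ l′) ψ (u l) _ ⟩
      dot (φ l′) (u l) - dot (φ l′) e * dot ψ (u l) ≈⟨ +-cong (D l l′) (-‿cong (trans (*-cong refl (ψ⊥u l)) (zeroʳ _))) ⟩
      δ l l′ - 0#                                ≈⟨ x-0≈x _ ⟩
      δ l l′                                     ∎

    D′ : Dual (e ∷ u) (ψ ∷ φ′)
    D′ fz     fz      = ψe≈1
    D′ fz     (fs l′) = φ′e≈0 l′
    D′ (fs l) fz      = ψ⊥u l
    D′ (fs l) (fs l′) = φ′u≈δ l l′

  indep⇒dual : ∀ {n} d (u : Fin d → Vect n) → LinIndep u → DN (Σ (Fin d → Vect n) (Dual u))
  indep⇒dual zero    u indep κ = κ ((λ ()) , (λ ()))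
  indep⇒dual (suc d) u indep κ =
    indep⇒dual d (tail u) (indep-tail u indep) λ (φ , D) →
    notAll (λ res≈0 → head-not-in-span u indep (residual-zero⇒InSpan res≈0)) λ (i₀ , res≉0) →
    κ (Dual-η (adjoin (tail u) φ D (head u) i₀ (inverse _ res≉0)))

  -- A dual pair of length d < n extends by one vector: some standard basis
  -- vector has a nonzero residual, since otherwise all n of them would lie
  -- in the span of the d vectors u.
  extend-dual : ∀ {n d} (u φ : Fin d → Vect n) → Dual u φ → d < n →
                DN (Σ (Vect n) λ e → Σ (Fin (suc d) → Vect n) (Dual (e ∷ u)))
  extend-dual {d = d} u φ D d<n κ =
    notAll (λ res≈0 → steinitz d δ u δ-indep (λ i → residual-zero⇒InSpan (res≈0 i)) d<n) λ (i , res≢0) →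
    notAll res≢0 λ (j , resᵢⱼ≉0) →
    κ (δ i , adjoin u φ D (δ i) j (inverse _ resᵢⱼ≉0))

  extend-dual-by : ∀ {n} k {d} (u φ : Fin d → Vect n) → Dual u φ → k ℕ.+ d ≤ n →
                   DN (Σ (Fin (k ℕ.+ d) → Vect n) λ a →
                       Σ (Fin (k ℕ.+ d) → Vect n) (Dual a) × (∀ l → a (k ↑ʳ l) ≡ u l))
  extend-dual-by zero    u φ D _   κ = κ (u , (φ , D) , λ l → P.refl)
  extend-dual-by (suc k) u φ D k<n κ =
    extend-dual-by k u φ D (<⇒≤ k<n) λ (a , (ψ , Da) , a↑≡u) →
    extend-dual a ψ Da k<n λ (e , D′) →
    κ (e ∷ a , D′ , a↑≡u)

  setOf : ∀ {n k} → (Fin k → Vect n) → VSet n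
  setOf a v = Lift c (∃ λ i → v ≈ᵥ a i)

  setOf-rank : ∀ {n k} (a : Fin k → Vect n) → LinIndep a → HasRank (setOf a) k
  setOf-rank a indep =
    a , (λ j → lift (j , λ i → refl)) , indep , λ { u (lift (j , u≈aⱼ)) → span-cong u≈aⱼ (span-member a j) }

  bilin-cong : ∀ {n m t} (E : Fin t → Mat n m) {v v′ w w′} → v ≈ᵥ v′ → w ≈ᵥ w′ →
               bilin E v w ≈ᵥ bilin E v′ w′
  bilin-cong E v≈ w≈ k = ∑-cong (λ i → ∑-cong (λ j → *-cong (v≈ i) (*-cong refl (w≈ j))))

  span-punchIn : ∀ {t K} (g : Fin (suc K) → Vect t) {s q : Fin (suc K)} → s ≢ q →
                 InSpan (g ∘ punchIn s) (g q)
  span-punchIn g {s} s≢q =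
    P.subst (λ q → InSpan (g ∘ punchIn s) (g q)) (punchIn-punchOut s≢q) (span-member _ (punchOut s≢q))

  drop-redundant : ∀ {t K d} (g : Fin (suc K) → Vect t) (s : Fin (suc K)) (c : Fin d → Fin (suc K)) →
                   (∀ l → c l ≢ s) → (∀ k → g s k + ∑ (λ l → g (c l) k) ≈ 0#) →
                   ∀ p → InSpan (g ∘ punchIn s) (g p)
  drop-redundant g s c c≢s rel p with s ≟ p
  ... | no  s≢p    = span-punchIn g s≢p
  ... | yes P.refl =
    span-cong (λ k → inverseˡ-unique _ _ (rel k))
              (span-neg (span-sum (g ∘ c) (λ l → span-punchIn g (c≢s l ∘ P.sym))))

  grid-relation⇒⊥ : ∀ {n m t d} (E : Fin t → Mat n m) R (a : Fin R → Vect n) (b : Fin R → Vect m)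
                    (ι : Fin (suc d) → Fin R) → (∀ l → ι (fs l) ≢ ι fz) →
                    (∀ k → ∑ (λ l → bilin E (a (ι l)) (b (ι l)) k) ≈ 0#) →
                    ¬ HasRank (image (bilin E) (setOf a) (setOf b)) (R ℕ.* R)
  grid-relation⇒⊥ E zero a b ι _ _ _ with ι fz
  ... | ()
  grid-relation⇒⊥ {t = t} {d} E R@(suc _) a b ι ι≢ rel rank =
    rank-bound (g ∘ punchIn s) rank image⊆span (n<1+n _)
    where
    g : Fin (R ℕ.* R) → Vect t
    g p = bilin E (a (proj₁ (remQuot {R} R p))) (b (proj₂ (remQuot {R} R p)))
    g-combine : ∀ i j → g (combine i j) ≈ᵥ bilin E (a i) (b j)
    g-combine i j k = reflexive (P.cong (λ ij → bilin E (a (proj₁ ij)) (b (proj₂ ij)) k) (remQuot-combine {R} {R} i j))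
    diag : Fin (suc d) → Fin (R ℕ.* R)
    diag l = combine (ι l) (ι l)
    s : Fin (R ℕ.* R)
    s = diag fz
    diag≢s : ∀ l → diag (fs l) ≢ s
    diag≢s l eq = ι≢ l (combine-injectiveˡ _ _ _ _ eq)
    rel′ : ∀ k → g s k + ∑ (λ l → g (diag (fs l)) k) ≈ 0#
    rel′ k = trans (+-cong (g-combine (ι fz) (ι fz) k) (∑-cong (λ l → g-combine (ι (fs l)) (ι (fs l)) k))) (rel k)
    image⊆span : ∀ u → image (bilin E) (setOf a) (setOf b) u → InSpan (g ∘ punchIn s) u
    image⊆span u (v , w , lift (i , v≈) , lift (j , w≈) , u≈) =
      span-cong (λ k → trans (u≈ k) (trans (bilin-cong E v≈ w≈ k) (sym (g-combine i j k))))
                (drop-redundant g s (diag ∘ fs) diag≢s rel′ (combine i j))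

  record Factorisation {n m} (M : Mat n m) (d : ℕ) : Set (c ⊔ ℓ) where
    field
      left       : Fin d → Vect n
      right      : Fin d → Vect m
      left-indep : LinIndep left
      right-dual : Σ (Fin d → Vect m) (Dual right)
      factorises : ∀ i j → M i j ≈ ∑ (λ l → right l j * left l i)

  -- Take a column basis as left family and the coordinate rows as right
  -- family; the right family is dual to the standard basis vectors at the
  -- column indices of the basis vectors.
  factorise : ∀ {n m d} {M : Mat n m} → MatRank M d → Factorisation M d
  factorise {n} {m} {d} {M} (basis , inColumns , indep , spans) = record
    { left       = basis
    ; right      = λ l j → C j l
    ; left-indep = indep
    ; right-dual = (λ l′ → δ (col l′)) , dual
    ; factorises = λ i j → proj₂ (spans _ (column j)) i
    }
    where
    column : ∀ (j : Fin m) → columns M (λ i → M i j)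
    column j = lift (j , λ i → refl)
    C : Fin m → Fin d → Carrier
    C j = proj₁ (spans _ (column j))
    col : Fin d → Fin m
    col l = proj₁ (lower (inColumns l))
    -- the basis vector l′ is column col l′, so its coordinates are δ l′
    C-col : ∀ l′ l → C (col l′) l ≈ δ l′ l
    C-col l′ l = coordinates-unique indep (λ i → begin
      lincomb (C (col l′)) basis i ≈⟨ proj₂ (spans _ (column (col l′))) i ⟨
      M i (col l′)                 ≈⟨ proj₂ (lower (inColumns l′)) i ⟨
      basis l′ i                   ≈⟨ ∑-δ l′ (λ l → basis l i) ⟨
      lincomb (δ l′) basis i       ∎) l
    dual : Dual (λ l j → C j l) (λ l′ → δ (col l′))
    dual l l′ = trans (∑-δ (col l′) (λ j → C j l)) (trans (C-col l′ l) (reflexive (δ-sym l′ l)))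

  rank-zero⇒zero : ∀ {n m} {M : Mat n m} → MatRank M zero → IsZeroMat M
  rank-zero⇒zero (_ , _ , _ , spans) i j = proj₂ (spans _ (lift (j , λ i → refl))) i

  trace-factorisation : ∀ {n m t d} (E : Fin t → Mat n m) (M : Mat n m) (v : Fin d → Vect n) (w : Fin d → Vect m) →
                        (∀ i j → M i j ≈ ∑ (λ l → w l j * v l i)) →
                        ∀ k → ∑ (λ l → bilin E (v l) (w l) k) ≈ trace (transpose (E k) ⊗ M)
  trace-factorisation {n} {m} {d = d} E M v w M≈ k = begin
    ∑ (λ l → ∑ (λ i → ∑ (λ j → term l i j)))  ≈⟨ ∑-swap (λ l i → ∑ (λ j → term l i j)) ⟩
    ∑ (λ i → ∑ (λ l → ∑ (λ j → term l i j)))  ≈⟨ ∑-cong (λ i → ∑-swap (λ l j → term l i j)) ⟩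
    ∑ (λ i → ∑ (λ j → ∑ (λ l → term l i j)))  ≈⟨ ∑-swap (λ i j → ∑ (λ l → term l i j)) ⟩
    ∑ (λ j → ∑ (λ i → ∑ (λ l → term l i j)))  ≈⟨ ∑-cong (λ j → ∑-cong (λ i → entry i j)) ⟩
    ∑ (λ j → ∑ (λ i → E k i j * M i j))       ∎
    where
    term : Fin d → Fin n → Fin m → Carrier
    term l i j = v l i * (E k i j * w l j)
    entry : ∀ i j → ∑ (λ l → v l i * (E k i j * w l j)) ≈ E k i j * M i j
    entry i j = begin
      ∑ (λ l → v l i * (E k i j * w l j)) ≈⟨ ∑-cong (λ l → trans (x∙yz≈y∙xz (v l i) _ _) (*-cong refl (*-comm (v l i) _))) ⟩
      ∑ (λ l → E k i j * (w l j * v l i)) ≈⟨ ∑-*ˡ (E k i j) (λ l → w l j * v l i) ⟩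
      E k i j * ∑ (λ l → w l j * v l i)   ≈⟨ *-cong refl (M≈ i j) ⟨
      E k i j * M i j                     ∎

  low-rank⇒⊥ : ∀ {n m t r} (E : Fin t → Mat n m) → r ≤ n → r ≤ m → IsLosslessCondenser r r (bilin E) →
               (M : Mat n m) → ¬ IsZeroMat M → (∀ k → trace (transpose (E k) ⊗ M) ≈ 0#) →
               ∀ {d} → MatRank M d → d ≤ r → ⊥
  low-rank⇒⊥ E _ _ _ M M≢0 _ {zero} rank _ = M≢0 (rank-zero⇒zero rank)
  low-rank⇒⊥ {n} {m} {r = r} E r≤n r≤m condenser M _ orth {d@(suc _)} rank d≤r =
    indep⇒dual d left left-indep λ (φ , D) →
    extend-dual-by k left φ D k+d≤n λ (a , (_ , Da) , a↑≡left) →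
    extend-dual-by k right (proj₁ right-dual) (proj₂ right-dual) k+d≤m λ (b , (_ , Db) , b↑≡right) →
    grid-relation⇒⊥ E (k ℕ.+ d) a b (k ↑ʳ_) ι≢
      (diagonal-relation a b a↑≡left b↑≡right)
      (condenser′ (setOf a) (setOf b) (setOf-rank a (Dual⇒Indep Da)) (setOf-rank b (Dual⇒Indep Db)))
    where
    open Factorisation (factorise rank)
    k : ℕ
    k = r ∸ d
    k+d≡r : k ℕ.+ d ≡ r
    k+d≡r = m∸n+n≡m d≤r
    k+d≤n : k ℕ.+ d ≤ n
    k+d≤n = P.subst (_≤ n) (P.sym k+d≡r) r≤n
    k+d≤m : k ℕ.+ d ≤ m
    k+d≤m = P.subst (_≤ m) (P.sym k+d≡r) r≤m
    condenser′ : IsLosslessCondenser (k ℕ.+ d) (k ℕ.+ d) (bilin E)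
    condenser′ = P.subst (λ z → IsLosslessCondenser z z (bilin E)) (P.sym k+d≡r) condenser
    diagonal-relation : (a : Fin (k ℕ.+ d) → Vect n) (b : Fin (k ℕ.+ d) → Vect m) →
                        (∀ l → a (k ↑ʳ l) ≡ left l) → (∀ l → b (k ↑ʳ l) ≡ right l) →
                        ∀ t → ∑ (λ l → bilin E (a (k ↑ʳ l)) (b (k ↑ʳ l)) t) ≈ 0#
    diagonal-relation a b a↑≡left b↑≡right t = begin
      ∑ (λ l → bilin E (a (k ↑ʳ l)) (b (k ↑ʳ l)) t)
        ≈⟨ ∑-cong (λ l → reflexive (P.cong₂ (λ v w → bilin E v w t) (a↑≡left l) (b↑≡right l))) ⟩
      ∑ (λ l → bilin E (left l) (right l) t)
        ≈⟨ trace-factorisation E M left right factorises t ⟩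
      trace (transpose (E t) ⊗ M)
        ≈⟨ orth t ⟩
      0# ∎
    ι≢ : ∀ l → k ↑ʳ fs l ≢ k ↑ʳ fz
    ι≢ l eq with ↑ʳ-injective k (fs l) fz eq
    ... | ()

propositionB4 : {c ℓ : Level} (F : Field c ℓ) → let open Field F in let open LinAlg F in
    (n m t r : ℕ) → 1 ≤ n → 1 ≤ m → r ≤ n → r ≤ m →
    (E : Fin t → Mat n m) →
    IsLosslessCondenser r r (bilin E) →
    (M : Mat n m) → ¬ IsZeroMat M →
    (∀ k → trace (transpose (E k) ⊗ M) ≈ 0#) →
    ∀ d → MatRank M d → suc r ≤ d
propositionB4 F n m t r _ _ r≤n r≤m E condenser M M≢0 orth d rank with suc r ≤? d
... | yes r<d = r<d
... | no  r≮d = ⊥-elim (Proof.low-rank⇒⊥ F E r≤n r≤m condenser M M≢0 orth rank (≤-pred (≰⇒> r≮d)))
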